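{- Let $w\in\widetilde{C}_n/C_n$ and let $\lambda\in L_n$ correspond to $w$ under the bijection $w\mapsto\lambda=(2c_1-e_1,\dots,2nc_n-e_n)$. Then \[ \mathsf{neg}(w)=2\sum_{i=1}^n\Big\lceil\frac{\lambda_i}{2i}\Big\rceil-\sum_{i=1}^n\Big\lceil\frac{\lambda_i}{i}\Big\rceil. \]
   Context: Let $N=2n+2$. $C_n$ is the set of signed permutations (integer sequences $\sigma$ with $(|\sigma_1|,\dots,|\sigma_n|)$ a permutation of $\{1,\dots,n\}$). $\widetilde{C}_n/C_n$ is the set of integer tuples $[w_1,\dots,w_n]$ with $0<w_1<\cdots<w_n$ such that $\pm w_1,\dots,\pm w_n$ are pairwise distinct modulo $N$ (windows of minimal length coset representatives of the affine hyperoctahedral group modulo the hyperoctahedral group); each has a unique representation $w_i=c_iN+\sigma_i$ with $c_i\in\mathbb{Z}$, $\sigma\in C_n$. $\mathsf{neg}(w)$ is defined as $\#\{i:\sigma_i<0\}$. $\Psi(\sigma)=(e_1,\dots,e_n)$ where, with $e^*_i=\#\{j<i:|\sigma_j|>|\sigma_i|\}$, $e_i=e^*_i$ if $\sigma_i>0$ and $e_i=2i-1-e^*_i$ if $\sigma_i<0$. $L_n$ is the set of integer tuples with $0\le\lambda_1/1\le\lambda_2/2\le\cdots\le\lambda_n/n$, and the map $w\mapsto(2c_1-e_1,4c_2-e_2,\dots,2nc_n-e_n)$ is a bijection $\widetilde{C}_n/C_n\to L_n$. -}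

module Defs where

open import Data.Nat as ℕ using (ℕ; suc)
open import Data.Fin using (Fin; toℕ; _<_)
open import Data.Integer as ℤ using (ℤ; +_; -_; _+_; _-_; _*_; ∣_∣; _/ℕ_)
open import Data.Integer.Divisibility using (_∣_)
open import Data.List using (List; filter; length; map; allFin; foldr)
open import Data.Product using (_×_)
open import Data.Empty using (⊥)
open import Relation.Binary.PropositionalEquality using (_≡_)
open import Relation.Nullary using (¬_)
import Data.Nat.Properties as ℕP
import Data.Integer.Properties as ℤP
import Data.Fin.Properties as FinP

-- Indices i : Fin n are 0-based; the paper's index is toℕ i + 1.

bigN : ℕ → ℕ
bigN n = 2 ℕ.* n ℕ.+ 2

IsSignedPerm : (n : ℕ) → (Fin n → ℤ) → Set
IsSignedPerm n σ =
  ((i : Fin n) → (1 ℕ.≤ ∣ σ i ∣) × (∣ σ i ∣ ℕ.≤ n)) ×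
  ((i j : Fin n) → ∣ σ i ∣ ≡ ∣ σ j ∣ → i ≡ j)

-- w ∈ C̃_n/C_n : 0 < w_1 < ⋯ < w_n and ±w_1,…,±w_n pairwise distinct mod N.
-- Pairwise distinctness of the 2n values ±w_i modulo N means:
--   w_i ≡ w_j (mod N) ⇒ i = j   (same for -w_i, -w_j), and
--   w_i ≢ -w_j (mod N) for all i, j (including i = j).
IsCosetWindow : (n : ℕ) → (Fin n → ℤ) → Set
IsCosetWindow n w =
  ((i : Fin n) → + 0 ℤ.< w i) ×
  ((i j : Fin n) → i < j → w i ℤ.< w j) ×
  ((i j : Fin n) → (+ bigN n) ∣ (w i - w j) → i ≡ j) ×
  ((i j : Fin n) → ¬ ((+ bigN n) ∣ (w i + w j)))

sumℤ : List ℤ → ℤ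
sumℤ = foldr _+_ (+ 0)

∑ : (n : ℕ) → (Fin n → ℤ) → ℤ
∑ n f = sumℤ (map f (allFin n))

-- neg(w) = #{ i : σ_i < 0 }
negCount : (n : ℕ) → (Fin n → ℤ) → ℕ
negCount n σ = length (filter (λ i → σ i ℤ.<? + 0) (allFin n))

eStar : (n : ℕ) → (Fin n → ℤ) → Fin n → ℕ
eStar n σ i =
  length (filter (λ j → ∣ σ i ∣ ℕ.<? ∣ σ j ∣) (filter (λ j → j Data.Fin.<? i) (allFin n)))

-- Ψ(σ)_i = e*_i if σ_i > 0, and 2i - 1 - e*_i if σ_i < 0 (i 1-based, so 2i-1 = 2·toℕ i + 1)
Psi : (n : ℕ) → (Fin n → ℤ) → Fin n → ℤ
Psi n σ i with σ i ℤ.<? + 0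
... | Relation.Nullary.yes _ = + (2 ℕ.* toℕ i ℕ.+ 1) - + eStar n σ i
... | Relation.Nullary.no _  = + eStar n σ i

lam : (n : ℕ) → (c σ : Fin n → ℤ) → Fin n → ℤ
lam n c σ i = + (2 ℕ.* suc (toℕ i)) * c i - Psi n σ i

ceilDiv : ℤ → (d : ℕ) → .{{ℕ.NonZero d}} → ℤ
ceilDiv x d = - ((- x) /ℕ d)

-- Write λᵢ = 2i cᵢ - eᵢ with 0 ≤ eᵢ < 2i. Then ⌈λᵢ / 2i⌉ = cᵢ, while ⌈λᵢ / i⌉ is 2cᵢ
-- when eᵢ < i and 2cᵢ - 1 when eᵢ ≥ i, so 2⌈λᵢ / 2i⌉ - ⌈λᵢ / i⌉ is the indicator of eᵢ ≥ i.
-- As e*ᵢ ≤ i - 1, the Ψ-offset eᵢ is e*ᵢ < i when σᵢ > 0 and 2i - 1 - e*ᵢ ≥ i when σᵢ < 0,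
-- so summing the indicators counts the negative entries of σ.

module Submission where

open import Data.Nat as ℕ using (ℕ; suc; _∸_; s≤s)
import Data.Nat.Properties as ℕP
open import Data.Integer as ℤ using (ℤ; +_; _+_; _-_; _*_; -_; _/ℕ_)
import Data.Integer.Properties as ℤP
open import Data.Integer.DivMod using ([n/ℕd]*d≤n; n<s[n/ℕd]*d)
open import Data.Integer.Tactic.RingSolver using (solve-∀)
import Data.Nat.Tactic.RingSolver as NatSolver
open import Data.Fin as Fin using (Fin; toℕ; _<?_)
open import Data.List using (List; []; _∷_; filter; length; map; allFin; tabulate)
import Data.List.Properties as ListP
open import Data.List.Relation.Unary.All using (universal)
open import Data.Product using (_,_)
open import Data.Bool using (true; false)
open import Function using (_∘_; id)
open import Relation.Nullary using (¬_; Dec; yes; no; does; contradiction)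
open import Relation.Unary using (Pred; Decidable)
open import Relation.Binary.PropositionalEquality
open import Defs

/ℕ-unique : ∀ y q r d .{{_ : ℕ.NonZero d}} → r ℕ.< d → y ≡ + r + q * + d → y /ℕ d ≡ q
/ℕ-unique y q r d r<d refl = ℤP.≤-antisym (<-suc⇒≤ y/d<1+q) (<-suc⇒≤ q<1+y/d)
  where
  <-suc⇒≤ : ∀ {a b} → a ℤ.< ℤ.suc b → a ℤ.≤ b
  <-suc⇒≤ {a} {b} a<1+b = subst (a ℤ.≤_) (ℤP.pred-suc b) (ℤP.i<j⇒i≤pred[j] a<1+b)
  y<[1+q]d : y ℤ.< ℤ.suc q * + d
  y<[1+q]d = subst (y ℤ.<_) (sym (ℤP.suc-* q (+ d))) (ℤP.+-monoˡ-< (q * + d) (ℤ.+<+ r<d))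
  y/d<1+q : y /ℕ d ℤ.< ℤ.suc q
  y/d<1+q = ℤP.*-cancelʳ-<-nonNeg (+ d) (ℤP.≤-<-trans ([n/ℕd]*d≤n y d) y<[1+q]d)
  q<1+y/d : q ℤ.< ℤ.suc (y /ℕ d)
  q<1+y/d = ℤP.*-cancelʳ-<-nonNeg (+ d)
              (ℤP.≤-<-trans (ℤP.i≤j+i (q * + d) (+ r)) (n<s[n/ℕd]*d y d))

ceilDiv-*-sub : ∀ k r d .{{_ : ℕ.NonZero d}} → r ℕ.< d → ceilDiv (+ d * k - + r) d ≡ k
ceilDiv-*-sub k r d r<d = begin
  - ((- (+ d * k - + r)) /ℕ d) ≡⟨ cong -_ (/ℕ-unique _ (- k) r d r<d (negate k (+ d) (+ r))) ⟩
  - - k                        ≡⟨ ℤP.neg-involutive k ⟩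
  k                            ∎
  where
  open ≡-Reasoning
  negate : ∀ k d r → - (d * k - r) ≡ r + (- k) * d
  negate = solve-∀

-- The i-th summand of the right-hand side, with t = i - 1 the 0-based index.
ceilGap : ℤ → ℕ → ℤ
ceilGap x t = + 2 * ceilDiv x (2 ℕ.* suc t) - ceilDiv x (suc t)

2*-* : ∀ m c → + (2 ℕ.* m) * c ≡ + m * (+ 2 * c)
2*-* m c = trans (cong (_* c) (ℤP.pos-* 2 m)) (reassoc (+ m) c)
  where
  reassoc : ∀ m c → + 2 * m * c ≡ m * (+ 2 * c)
  reassoc = solve-∀

ceilGap-low : ∀ c t r → r ℕ.< suc t → ceilGap (+ (2 ℕ.* suc t) * c - + r) t ≡ + 0
ceilGap-low c t r r<1+t = begin
  + 2 * ceilDiv x (2 ℕ.* suc t) - ceilDiv x (suc t)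
    ≡⟨ cong (λ y → + 2 * y - ceilDiv x (suc t)) (ceilDiv-*-sub c r (2 ℕ.* suc t) r<2+2t) ⟩
  + 2 * c - ceilDiv x (suc t)
    ≡⟨ cong (λ y → + 2 * c - ceilDiv (y - + r) (suc t)) (2*-* (suc t) c) ⟩
  + 2 * c - ceilDiv (+ suc t * (+ 2 * c) - + r) (suc t)
    ≡⟨ cong (λ y → + 2 * c - y) (ceilDiv-*-sub (+ 2 * c) r (suc t) r<1+t) ⟩
  + 2 * c - + 2 * c
    ≡⟨ ℤP.+-inverseʳ (+ 2 * c) ⟩
  + 0 ∎
  where
  open ≡-Reasoning
  x = + (2 ℕ.* suc t) * c - + r
  r<2+2t : r ℕ.< 2 ℕ.* suc t
  r<2+2t = ℕP.<-≤-trans r<1+t (ℕP.m≤n*m (suc t) 2)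

ceilGap-high : ∀ c t r → r ℕ.< suc t → ceilGap (+ (2 ℕ.* suc t) * c - (+ suc t + + r)) t ≡ + 1
ceilGap-high c t r r<1+t = begin
  + 2 * ceilDiv x (2 ℕ.* suc t) - ceilDiv x (suc t)
    ≡⟨ cong₂ (λ y z → + 2 * y - ceilDiv z (suc t)) ceilDiv-x-[2+2t]≡c
             (trans (cong (λ y → y - (+ suc t + + r)) (2*-* (suc t) c)) (shift (+ suc t) c (+ r))) ⟩
  + 2 * c - ceilDiv (+ suc t * (+ 2 * c - + 1) - + r) (suc t)
    ≡⟨ cong (λ y → + 2 * c - y) (ceilDiv-*-sub (+ 2 * c - + 1) r (suc t) r<1+t) ⟩
  + 2 * c - (+ 2 * c - + 1)
    ≡⟨ cancel c ⟩
  + 1 ∎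
  where
  open ≡-Reasoning
  x = + (2 ℕ.* suc t) * c - (+ suc t + + r)
  shift : ∀ m c r → m * (+ 2 * c) - (m + r) ≡ m * (+ 2 * c - + 1) - r
  shift = solve-∀
  cancel : ∀ c → + 2 * c - (+ 2 * c - + 1) ≡ + 1
  cancel = solve-∀
  t+1+r<2t+2 : suc t ℕ.+ r ℕ.< 2 ℕ.* suc t
  t+1+r<2t+2 = ℕP.<-≤-trans (ℕP.+-monoʳ-< (suc t) r<1+t)
                             (ℕP.≤-reflexive (cong (suc t ℕ.+_) (sym (ℕP.+-identityʳ (suc t)))))
  ceilDiv-x-[2+2t]≡c : ceilDiv x (2 ℕ.* suc t) ≡ c
  ceilDiv-x-[2+2t]≡c =
    trans (cong (λ y → ceilDiv (+ (2 ℕ.* suc t) * c - y) (2 ℕ.* suc t)) (sym (ℤP.pos-+ (suc t) r)))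
          (ceilDiv-*-sub c (suc t ℕ.+ r) (2 ℕ.* suc t) t+1+r<2t+2)

filter-map : ∀ {A B : Set} {p} {P : Pred B p} (P? : Decidable P) (f : A → B) (xs : List A) →
             filter P? (map f xs) ≡ map f (filter (P? ∘ f) xs)
filter-map P? f []       = refl
filter-map P? f (x ∷ xs) with does (P? (f x))
... | true  = cong (f x ∷_) (filter-map P? f xs)
... | false = filter-map P? f xs

length-filter-<-allFin : ∀ m (i : Fin m) → length (filter (_<? i) (allFin m)) ≡ toℕ i
length-filter-<-allFin (suc m) Fin.zero =
  cong length (ListP.filter-none (_<? Fin.zero {m}) (universal (λ _ ()) (allFin (suc m))))
length-filter-<-allFin (suc m) (Fin.suc i) = cong suc (begin
  length (filter (_<? Fin.suc i) (tabulate sucₘ))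
    ≡⟨ cong (length ∘ filter (_<? Fin.suc i)) (sym (ListP.map-tabulate id sucₘ)) ⟩
  length (filter (_<? Fin.suc i) (map sucₘ (allFin m)))
    ≡⟨ cong length (filter-map (_<? Fin.suc i) sucₘ (allFin m)) ⟩
  length (map sucₘ (filter ((_<? Fin.suc i) ∘ sucₘ) (allFin m)))
    ≡⟨ ListP.length-map sucₘ (filter ((_<? Fin.suc i) ∘ sucₘ) (allFin m)) ⟩
  length (filter ((_<? Fin.suc i) ∘ sucₘ) (allFin m))
    ≡⟨ cong length (ListP.filter-≐ _ (_<? i) (ℕ.s≤s⁻¹ , s≤s) (allFin m)) ⟩
  length (filter (_<? i) (allFin m))
    ≡⟨ length-filter-<-allFin m i ⟩
  toℕ i ∎)
  where
  open ≡-Reasoning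
  sucₘ : Fin m → Fin (suc m)
  sucₘ = Fin.suc

eStar≤toℕ : ∀ n σ (i : Fin n) → eStar n σ i ℕ.≤ toℕ i
eStar≤toℕ n σ i = ℕP.≤-trans (ListP.length-filter _ (filter (_<? i) (allFin n)))
                             (ℕP.≤-reflexive (length-filter-<-allFin n i))

Psi-nonneg : ∀ n σ (i : Fin n) → ¬ σ i ℤ.< + 0 → Psi n σ i ≡ + eStar n σ i
Psi-nonneg n σ i σᵢ≮0 with σ i ℤ.<? + 0
... | yes σᵢ<0 = contradiction σᵢ<0 σᵢ≮0
... | no _     = refl

Psi-neg : ∀ n σ (i : Fin n) → σ i ℤ.< + 0 → Psi n σ i ≡ + suc (toℕ i) + + (toℕ i ∸ eStar n σ i)
Psi-neg n σ i σᵢ<0 with σ i ℤ.<? + 0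
... | no σᵢ≮0 = contradiction σᵢ<0 σᵢ≮0
... | yes _   = begin
  + (2 ℕ.* t ℕ.+ 1) - + e     ≡⟨ cong (λ m → + m - + e) (2t+1≡1+t+t t) ⟩
  + (suc t ℕ.+ t) - + e       ≡⟨ cong (_- + e) (ℤP.pos-+ (suc t) t) ⟩
  + suc t + + t - + e         ≡⟨ ℤP.+-assoc (+ suc t) (+ t) (- + e) ⟩
  + suc t + (+ t - + e)       ≡⟨ cong (ℤ._+_ (+ suc t)) (trans (ℤP.m-n≡m⊖n t e) (ℤP.⊖-≥ e≤t)) ⟩
  + suc t + + (t ∸ e)         ∎
  where
  open ≡-Reasoning
  t = toℕ i
  e = eStar n σ i
  e≤t : e ℕ.≤ t
  e≤t = eStar≤toℕ n σ i
  2t+1≡1+t+t : ∀ t → 2 ℕ.* t ℕ.+ 1 ≡ suc t ℕ.+ t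
  2t+1≡1+t+t = NatSolver.solve-∀

indicator : ∀ {p} {P : Set p} → Dec P → ℤ
indicator (yes _) = + 1
indicator (no _)  = + 0

ceilGap-lam : ∀ n c σ (i : Fin n) (σᵢ<?0 : Dec (σ i ℤ.< + 0)) →
              ceilGap (lam n c σ i) (toℕ i) ≡ indicator σᵢ<?0
ceilGap-lam n c σ i σᵢ<?0 = go σᵢ<?0
  where
  t = toℕ i
  e* = eStar n σ i
  gapAt : ℤ → ℤ
  gapAt e = ceilGap (+ (2 ℕ.* suc t) * c i - e) t
  go : (d : Dec (σ i ℤ.< + 0)) → ceilGap (lam n c σ i) t ≡ indicator d
  go (yes σᵢ<0) = trans (cong gapAt (Psi-neg n σ i σᵢ<0))
                        (ceilGap-high (c i) t (t ∸ e*) (s≤s (ℕP.m∸n≤m t e*)))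
  go (no σᵢ≮0)  = trans (cong gapAt (Psi-nonneg n σ i σᵢ≮0))
                        (ceilGap-low (c i) t e* (s≤s (eStar≤toℕ n σ i)))

sumℤ-indicator : ∀ {A : Set} {p} {P : Pred A p} (P? : Decidable P) (xs : List A) →
                 sumℤ (map (indicator ∘ P?) xs) ≡ + length (filter P? xs)
sumℤ-indicator P? []       = refl
sumℤ-indicator P? (x ∷ xs) with P? x
... | yes _ = trans (cong (ℤ._+_ (+ 1)) (sumℤ-indicator P? xs))
                    (sym (ℤP.pos-+ 1 (length (filter P? xs))))
... | no _  = trans (ℤP.+-identityˡ _) (sumℤ-indicator P? xs)

sumℤ-2*-sub : ∀ {A : Set} (f g : A → ℤ) (xs : List A) →
              + 2 * sumℤ (map f xs) - sumℤ (map g xs) ≡ sumℤ (map (λ x → + 2 * f x - g x) xs)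
sumℤ-2*-sub f g []       = refl
sumℤ-2*-sub f g (x ∷ xs) = trans (regroup (f x) (g x) (sumℤ (map f xs)) (sumℤ (map g xs)))
                                 (cong (ℤ._+_ (+ 2 * f x - g x)) (sumℤ-2*-sub f g xs))
  where
  regroup : ∀ a b F G → + 2 * (a + F) - (b + G) ≡ (+ 2 * a - b) + (+ 2 * F - G)
  regroup = solve-∀

mainTheorem14 : (n : ℕ) (w c σ : Fin n → ℤ) →
    IsCosetWindow n w →
    IsSignedPerm n σ →
    ((i : Fin n) → w i ≡ c i * + bigN n + σ i) →
    + negCount n σ ≡
      + 2 * ∑ n (λ i → ceilDiv (lam n c σ i) (2 ℕ.* suc (toℕ i)))
        - ∑ n (λ i → ceilDiv (lam n c σ i) (suc (toℕ i)))
mainTheorem14 n w c σ _ _ _ = sym (begin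
  + 2 * ∑ n (λ i → ceilDiv (lam n c σ i) (2 ℕ.* suc (toℕ i)))
    - ∑ n (λ i → ceilDiv (lam n c σ i) (suc (toℕ i)))
    ≡⟨ sumℤ-2*-sub _ _ (allFin n) ⟩
  ∑ n (λ i → ceilGap (lam n c σ i) (toℕ i))
    ≡⟨ cong sumℤ (ListP.map-cong (λ i → ceilGap-lam n c σ i (σ i ℤ.<? + 0)) (allFin n)) ⟩
  ∑ n (indicator ∘ (λ i → σ i ℤ.<? + 0))
    ≡⟨ sumℤ-indicator (λ i → σ i ℤ.<? + 0) (allFin n) ⟩
  + negCount n σ ∎)
  where open ≡-Reasoning
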